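{- Let $\Gamma$ be the geometry of the complete graph $K_v$ with $v\ge 4$. Then the triangle complex $\Delta(\Gamma)$ is connected and not residually connected.
   Context: The geometry of $K_v$ is the linear space whose points are the $v$ vertices of the complete graph and whose lines are its edges, incidence being containment. Triangle complex: $\Delta(\Gamma)$ is the rank three incidence system over $\{1,2,3\}$ whose elements are the triples $(p,L,i)$ with $p$ incident with $L$ and $i\in\{1,2,3\}$; the type of $(p,L,i)$ is $i$; and $(p,L,i)$ is incident with $(p',L',i \bmod 3+1)$ if and only if the set of points incident with both $L$ and $L'$ is exactly $\{p\}$ and $p\neq p'$ (incidence symmetric and reflexive, no other incidences). Connected means the incidence graph (edges between incident elements of different types) is connected; residually connected means the incidence graph of every residue of rank at least $2$ (residue of a flag $F$: elements incident with all of $F$ not in $F$, rank $3-|F|$), including the whole geometry, is connected. -}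

module Defs where

open import Level using (0ℓ)
open import Data.Nat using (ℕ)
open import Data.Fin using (Fin; zero; suc; _<_)
open import Data.Product using (Σ; _×_; _,_; proj₁)
open import Data.Sum using (_⊎_)
open import Data.Maybe using (Maybe; just; nothing)
open import Data.Unit using (⊤)
open import Relation.Nullary using (¬_)
open import Relation.Binary.PropositionalEquality using (_≡_)
open import Relation.Binary.Construct.Closure.ReflexiveTransitive using (Star)

record PointLineGeometry : Set₁ where
  field
    Point : Set
    Line  : Set
    _I_   : Point → Line → Set

Edge : ℕ → Set
Edge v = Σ (Fin v × Fin v) λ ab → proj₁ ab < Data.Product.proj₂ ab

KGeometry : ℕ → PointLineGeometry
KGeometry v = record
  { Point = Fin v
  ; Line  = Edge v
  ; _I_   = λ p e → (p ≡ proj₁ (proj₁ e)) ⊎ (p ≡ Data.Product.proj₂ (proj₁ e))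
  }

-- Rank three incidence systems over the type set {1,2,3},
-- types encoded as Fin 3 (zero ↦ 1, suc zero ↦ 2, suc (suc zero) ↦ 3).

record IncidenceSystem3 : Set₁ where
  field
    Elt  : Set
    type : Elt → Fin 3
    _*_  : Elt → Elt → Set

-- i mod 3 + 1 on the encoded types
next : Fin 3 → Fin 3
next zero = suc zero
next (suc zero) = suc (suc zero)
next (suc (suc zero)) = zero

module _ (Γ : PointLineGeometry) where
  open PointLineGeometry Γ

  ΔElt : Set
  ΔElt = Σ Point λ p → Σ Line λ L → (p I L) × Fin 3

  ΔPoint : ΔElt → Point
  ΔPoint (p , _) = p

  ΔLine : ΔElt → Line
  ΔLine (_ , L , _) = L

  ΔType : ΔElt → Fin 3
  ΔType (_ , _ , _ , i) = i

  ΔGen : ΔElt → ΔElt → Set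
  ΔGen x y =
    (ΔType y ≡ next (ΔType x))
    × (∀ q → ((q I ΔLine x) × (q I ΔLine y)) → q ≡ ΔPoint x)
    × ((ΔPoint x I ΔLine x) × (ΔPoint x I ΔLine y))
    × ¬ (ΔPoint x ≡ ΔPoint y)

  ΔInc : ΔElt → ΔElt → Set
  ΔInc x y = (x ≡ y) ⊎ ΔGen x y ⊎ ΔGen y x

  TriangleComplex : IncidenceSystem3
  TriangleComplex = record { Elt = ΔElt ; type = ΔType ; _*_ = ΔInc }

module _ (G : IncidenceSystem3) where
  open IncidenceSystem3 G

  Adjacent : Elt → Elt → Set
  Adjacent x y = (x * y) × ¬ (type x ≡ type y)

  ConnectedOn : (Elt → Set) → Set
  ConnectedOn S = (x y : Σ Elt S) →
    Star (λ a b → Adjacent (proj₁ a) (proj₁ b)) x y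

  Connected : Set
  Connected = ConnectedOn (λ _ → ⊤)

  -- In rank 3 the flags F with rank 3 - |F| ≥ 2 are the empty flag
  -- (nothing) and the flags {x} consisting of one element (just x).
  Residue : Maybe Elt → Elt → Set
  Residue nothing  y = ⊤
  Residue (just x) y = (x * y) × ¬ (y ≡ x)

  ResiduallyConnected : Set
  ResiduallyConnected = (F : Maybe Elt) → ConnectedOn (Residue F)

-- In K_v an element (p, {p,a}, i) of Δ is an ordered pair of distinct
-- vertices with a type, and (p,a,i) is incident with (b,p,i+1) exactly
-- when b ∉ {p,a}.  With v ≥ 4 one can always pick b avoiding three given
-- vertices, which lets one change either coordinate of a flag through a
-- common neighbour; together with the type-raising steps this connects
-- everything.  The residue of x₀ = (0,{0,1},1) consists of the flags
-- (b,{0,b},2) and (1,{1,b},3) with b ∉ {0,1}, and its incidence graph only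
-- joins the two flags with the same b; for v ≥ 4 there are two such b.
module Submission where

open import Defs
open import Level using (0ℓ)
open import Data.Nat using (ℕ; _≤_; s≤s)
import Data.Nat as ℕ
open import Data.Nat.Properties using (<⇒≱)
open import Data.Fin using (Fin; suc; _<_; _≟_)
open import Data.Fin.Patterns using (0F; 1F; 2F; 3F)
open import Data.Fin.Properties using (<-cmp; <-irrefl; <-asym; <-irrelevant; any?; ¬∀⟶∃¬; injective⇒≤)
open import Data.Product using (Σ; ∃; ∃₂; _×_; _,_; proj₁; proj₂; map₂)
open import Data.Sum using (_⊎_; inj₁; inj₂)
open import Data.Unit using (tt)
open import Data.Maybe using (just)
open import Data.Empty using (⊥-elim)
import Data.Empty.Irrelevant as Irrelevant
open import Function using (_∘_; _∋_; id; case_of_)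
open import Relation.Nullary using (¬_)
open import Relation.Binary using (Rel; Symmetric; tri<; tri≈; tri>)
open import Relation.Binary.PropositionalEquality
  using (_≡_; _≢_; refl; sym; trans; cong; subst; subst₂)
open import Relation.Binary.Construct.Closure.ReflexiveTransitive
  using (Star; ε; _◅_; _◅◅_; gmap; fold; reverse)

surjective⇒≤ : ∀ {m n} (f : Fin m → Fin n) → (∀ y → ∃ λ x → f x ≡ y) → n ≤ m
surjective⇒≤ f onto = injective⇒≤ {f = proj₁ ∘ onto} section-injective
  where
  section-injective : ∀ {y y′} → proj₁ (onto y) ≡ proj₁ (onto y′) → y ≡ y′
  section-injective {y} {y′} eq =
    trans (sym (proj₂ (onto y))) (trans (cong f eq) (proj₂ (onto y′)))

nonSurjective : ∀ {m n} → m ℕ.< n → (f : Fin m → Fin n) → ∃ λ y → ∀ x → f x ≢ y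
nonSurjective {n = n} m<n f =
  map₂ (λ notHit x fx≡y → notHit (x , fx≡y))
       (¬∀⟶∃¬ n _ (λ y → any? (λ x → f x ≟ y)) (<⇒≱ m<n ∘ surjective⇒≤ f))

avoid₃ : ∀ {v} → 3 ℕ.< v → (a b c : Fin v) → ∃ λ d → a ≢ d × b ≢ d × c ≢ d
avoid₃ 3<v a b c with nonSurjective 3<v (λ { 0F → a ; 1F → b ; 2F → c })
... | d , notHit = d , notHit 0F , notHit 1F , notHit 2F

next≢id : ∀ i → next i ≢ i
next≢id 0F ()
next≢id 1F ()
next≢id 2F ()

next-orbit : ∀ i j → i ≡ j ⊎ j ≡ next i ⊎ i ≡ next j
next-orbit 0F 0F = inj₁ refl
next-orbit 0F 1F = inj₂ (inj₁ refl)
next-orbit 0F 2F = inj₂ (inj₂ refl)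
next-orbit 1F 0F = inj₂ (inj₂ refl)
next-orbit 1F 1F = inj₁ refl
next-orbit 1F 2F = inj₂ (inj₁ refl)
next-orbit 2F 0F = inj₂ (inj₁ refl)
next-orbit 2F 1F = inj₂ (inj₂ refl)
next-orbit 2F 2F = inj₁ refl

module _ (Γ : PointLineGeometry) where

  ΔGen⇒Adjacent : ∀ {x y} → ΔGen Γ x y → Adjacent (TriangleComplex Γ) x y
  ΔGen⇒Adjacent {x} g = inj₂ (inj₁ g) , λ tx≡ty → next≢id (ΔType Γ x) (sym (trans tx≡ty (proj₁ g)))

  ΔGen-type : ∀ {x y i j} → ΔGen Γ x y → ΔType Γ x ≡ i → ΔType Γ y ≡ j → j ≡ next i
  ΔGen-type gxy x≡i y≡j = trans (sym y≡j) (trans (proj₁ gxy) (cong next x≡i))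

  Adjacent-sym : Symmetric (Adjacent (TriangleComplex Γ))
  Adjacent-sym (inj₁ x≡y        , tx≢ty) = inj₁ (sym x≡y)        , tx≢ty ∘ sym
  Adjacent-sym (inj₂ (inj₁ gxy) , tx≢ty) = inj₂ (inj₂ gxy) , tx≢ty ∘ sym
  Adjacent-sym (inj₂ (inj₂ gyx) , tx≢ty) = inj₂ (inj₁ gyx) , tx≢ty ∘ sym

Elt : ℕ → Set
Elt v = ΔElt (KGeometry v)

ΔK : ℕ → IncidenceSystem3
ΔK v = TriangleComplex (KGeometry v)

module _ {v : ℕ} where
  open PointLineGeometry (KGeometry v) using (_I_)

  edge : (p a : Fin v) → .(p ≢ a) → Edge v
  edge p a p≢a with <-cmp p a
  ... | tri< p<a _ _ = (p , a) , p<a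
  ... | tri≈ _ p≡a _ = Irrelevant.⊥-elim (p≢a p≡a)
  ... | tri> _ _ a<p = (a , p) , a<p

  edge-incidentˡ : ∀ p a .(p≢a : p ≢ a) → p I edge p a p≢a
  edge-incidentˡ p a p≢a with <-cmp p a
  ... | tri< _ _ _ = inj₁ refl
  ... | tri≈ _ p≡a _ = Irrelevant.⊥-elim (p≢a p≡a)
  ... | tri> _ _ _ = inj₂ refl

  edge-incidentʳ : ∀ p a .(p≢a : p ≢ a) → a I edge p a p≢a
  edge-incidentʳ p a p≢a with <-cmp p a
  ... | tri< _ _ _ = inj₂ refl
  ... | tri≈ _ p≡a _ = Irrelevant.⊥-elim (p≢a p≡a)
  ... | tri> _ _ _ = inj₁ refl

  edge-incident⁻ : ∀ {p a q} .{p≢a : p ≢ a} → q I edge p a p≢a → q ≡ p ⊎ q ≡ a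
  edge-incident⁻ {p} {a} {p≢a = p≢a} q∈pa with <-cmp p a | q∈pa
  ... | tri< _ _ _ | q∈pa′ = q∈pa′
  ... | tri≈ _ p≡a _ | _ = Irrelevant.⊥-elim (p≢a p≡a)
  ... | tri> _ _ _ | inj₁ q≡a = inj₂ q≡a
  ... | tri> _ _ _ | inj₂ q≡p = inj₁ q≡p

  flag : (p a : Fin v) → .(p ≢ a) → Fin 3 → Elt v
  flag p a p≢a i = p , edge p a p≢a , edge-incidentˡ p a p≢a , i

  flag-view : (x : Elt v) → ∃₂ λ a (p≢a : ΔPoint _ x ≢ a) → x ≡ flag (ΔPoint _ x) a p≢a (ΔType _ x)
  flag-view (p , ((.p , a) , p<a) , inj₁ refl , i) = a , (λ p≡a → <-irrefl p≡a p<a) , is-flag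
    where
    is-flag : (p , ((p , a) , p<a) , inj₁ refl , i) ≡ flag p a (λ p≡a → <-irrefl p≡a p<a) i
    is-flag with <-cmp p a
    ... | tri< p<a′ _ _ = cong (λ lt → p , ((p , a) , lt) , inj₁ refl , i) (<-irrelevant p<a p<a′)
    ... | tri≈ _ p≡a _ = ⊥-elim (<-irrefl p≡a p<a)
    ... | tri> _ _ a<p = ⊥-elim (<-asym p<a a<p)
  flag-view (p , ((a , .p) , a<p) , inj₂ refl , i) = a , (λ p≡a → <-irrefl (sym p≡a) a<p) , is-flag
    where
    is-flag : (p , ((a , p) , a<p) , inj₂ refl , i) ≡ flag p a (λ p≡a → <-irrefl (sym p≡a) a<p) i
    is-flag with <-cmp p a
    ... | tri< p<a _ _ = ⊥-elim (<-asym a<p p<a)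
    ... | tri≈ _ p≡a _ = ⊥-elim (<-irrefl (sym p≡a) a<p)
    ... | tri> _ _ a<p′ = cong (λ lt → p , ((a , p) , lt) , inj₂ refl , i) (<-irrelevant a<p a<p′)

  flag-gen : ∀ {p a b} .(p≢a : p ≢ a) (b≢p : b ≢ p) → a ≢ b → ∀ i →
             ΔGen (KGeometry v) (flag p a p≢a i) (flag b p b≢p (next i))
  flag-gen {p} {a} {b} p≢a b≢p a≢b i =
    refl , meet , (edge-incidentˡ p a p≢a , edge-incidentʳ b p b≢p) , b≢p ∘ sym
    where
    meet : ∀ q → q I edge p a p≢a × q I edge b p b≢p → q ≡ p
    meet q (q∈pa , q∈bp) with edge-incident⁻ q∈pa | edge-incident⁻ q∈bp
    ... | inj₁ q≡p | _        = q≡p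
    ... | inj₂ _   | inj₂ q≡p = q≡p
    ... | inj₂ q≡a | inj₁ q≡b = ⊥-elim (a≢b (trans (sym q≡a) q≡b))

module Connectivity {v : ℕ} (3<v : 3 ℕ.< v) where

  infix 4 _~_
  _~_ : Rel (Elt v) 0ℓ
  _~_ = Star (Adjacent (ΔK v))

  ~-sym : Symmetric _~_
  ~-sym = reverse (Adjacent-sym (KGeometry v))

  ~-gen : ∀ {p a b} .(p≢a : p ≢ a) (b≢p : b ≢ p) → a ≢ b → ∀ i →
          flag p a p≢a i ~ flag b p b≢p (next i)
  ~-gen p≢a b≢p a≢b i = ΔGen⇒Adjacent (KGeometry v) (flag-gen p≢a b≢p a≢b i) ◅ ε

  ~-moveOther : ∀ {p a a′} .(p≢a : p ≢ a) .(p≢a′ : p ≢ a′) i →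
                flag p a p≢a i ~ flag p a′ p≢a′ i
  ~-moveOther {p} {a} {a′} p≢a p≢a′ i with avoid₃ 3<v p a a′
  ... | b , p≢b , a≢b , a′≢b =
    ~-gen p≢a (p≢b ∘ sym) a≢b i ◅◅ ~-sym (~-gen p≢a′ (p≢b ∘ sym) a′≢b i)

  ~-movePoint : ∀ {q q′ r} (q≢r : q ≢ r) (q′≢r : q′ ≢ r) k →
                flag q r q≢r (next k) ~ flag q′ r q′≢r (next k)
  ~-movePoint {q} {q′} {r} q≢r q′≢r k with avoid₃ 3<v r q q′
  ... | s , r≢s , q≢s , q′≢s =
    ~-sym (~-gen r≢s q≢r (q≢s ∘ sym) k) ◅◅ ~-gen r≢s q′≢r (q′≢s ∘ sym) k

  ~-sameType : ∀ {p a q b} (p≢a : p ≢ a) (q≢b : q ≢ b) k →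
               flag p a p≢a (next k) ~ flag q b q≢b (next k)
  ~-sameType {p} {q = q} p≢a q≢b k with avoid₃ 3<v p q q
  ... | c , p≢c , q≢c , _ =
    ~-moveOther p≢a p≢c (next k) ◅◅ ~-movePoint p≢c q≢c k ◅◅ ~-moveOther q≢c q≢b (next k)

  ~-nextType : ∀ {p a q b} (p≢a : p ≢ a) (q≢b : q ≢ b) i →
               flag p a p≢a i ~ flag q b q≢b (next i)
  ~-nextType {p} {a} p≢a q≢b i with avoid₃ 3<v p a a
  ... | c , p≢c , a≢c , _ = ~-gen p≢a (p≢c ∘ sym) a≢c i ◅◅ ~-sameType (p≢c ∘ sym) q≢b i

  ~-flags : ∀ {p a q b} (p≢a : p ≢ a) (q≢b : q ≢ b) i j →
            flag p a p≢a i ~ flag q b q≢b j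
  ~-flags p≢a q≢b i j with next-orbit i j
  ... | inj₁ refl        = ~-nextType p≢a p≢a i ◅◅ ~-sym (~-nextType q≢b p≢a i)
  ... | inj₂ (inj₁ refl) = ~-nextType p≢a q≢b i
  ... | inj₂ (inj₂ refl) = ~-sym (~-nextType q≢b p≢a j)

  ~-all : ∀ x y → x ~ y
  ~-all x y with flag-view x | flag-view y
  ... | a , p≢a , x≡flag | b , q≢b , y≡flag =
    subst₂ _~_ (sym x≡flag) (sym y≡flag) (~-flags p≢a q≢b (ΔType _ x) (ΔType _ y))

  connected : Connected (ΔK v)
  connected (x , _) (y , _) = gmap (_, tt) id (~-all x y)

lower upper : ∀ {v} → Elt v → Fin v
lower x = proj₁ (proj₁ (ΔLine _ x))
upper x = proj₂ (proj₁ (ΔLine _ x))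

<1F⇒≡0F : ∀ {n} {l : Fin (2 ℕ.+ n)} → l < (Fin (2 ℕ.+ n) ∋ 1F) → l ≡ 0F
<1F⇒≡0F {l = 0F}    _ = refl
<1F⇒≡0F {l = suc _} (s≤s ())

next≡0F⇒2F : ∀ t → 0F ≡ next t → t ≡ 2F
next≡0F⇒2F 2F _ = refl

-- In the residue of x₀ the vertex b ∉ {0,1} is the upper end of the line,
-- since 0 and 1 are the two smallest vertices.
module ResidueOfBaseFlag {n : ℕ} where

  Γ : PointLineGeometry
  Γ = KGeometry (2 ℕ.+ n)

  x₀ : Elt (2 ℕ.+ n)
  x₀ = flag 0F 1F (λ ()) 0F

  InResidue : Elt (2 ℕ.+ n) → Set
  InResidue = Residue (ΔK (2 ℕ.+ n)) (just x₀)

  residue-gen : ∀ {y} → InResidue y → ΔGen Γ x₀ y ⊎ ΔGen Γ y x₀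
  residue-gen (inj₁ x₀≡y , y≢x₀) = ⊥-elim (y≢x₀ (sym x₀≡y))
  residue-gen (inj₂ gen , _)     = gen

  gen-from-x₀ : ∀ y → ΔGen Γ x₀ y → ΔType Γ y ≡ 1F × ΔPoint Γ y ≢ 1F × upper y ≡ ΔPoint Γ y
  gen-from-x₀ (p , ((l , h) , l<h) , p∈lh , t) (t≡1 , meet , (_ , 0∈lh) , 0≢p) =
    t≡1 , p≢1 p∈lh , upper≡p p∈lh 0∈lh
    where
    p≢1 : p ≡ l ⊎ p ≡ h → p ≢ 1F
    p≢1 (inj₁ p≡l) p≡1 = case meet 1F (inj₂ refl , inj₁ (trans (sym p≡1) p≡l)) of λ ()
    p≢1 (inj₂ p≡h) p≡1 = case meet 1F (inj₂ refl , inj₂ (trans (sym p≡1) p≡h)) of λ ()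
    upper≡p : p ≡ l ⊎ p ≡ h → 0F ≡ l ⊎ 0F ≡ h → h ≡ p
    upper≡p (inj₂ p≡h) _          = sym p≡h
    upper≡p (inj₁ p≡l) (inj₁ 0≡l) = ⊥-elim (0≢p (trans 0≡l (sym p≡l)))
    upper≡p (inj₁ _)   (inj₂ 0≡h) = case subst (l <_) (sym 0≡h) l<h of λ ()

  gen-to-x₀ : ∀ z → ΔGen Γ z x₀ → ΔType Γ z ≡ 2F × lower z ≡ 1F
  gen-to-x₀ (p , ((l , h) , l<h) , p∈lh , t) (0≡next-t , meet , (_ , p∈01) , p≢0) =
    next≡0F⇒2F t 0≡next-t , lower≡1 p∈01 p∈lh
    where
    lower≡1 : p ≡ 0F ⊎ p ≡ 1F → p ≡ l ⊎ p ≡ h → l ≡ 1F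
    lower≡1 (inj₁ p≡0) _          = ⊥-elim (p≢0 p≡0)
    lower≡1 (inj₂ p≡1) (inj₁ p≡l) = trans (sym p≡l) p≡1
    lower≡1 (inj₂ p≡1) (inj₂ p≡h) = case trans (meet 0F (inj₁ (sym l≡0) , inj₁ refl)) p≡1 of λ ()
      where
      l≡0 : l ≡ 0F
      l≡0 = <1F⇒≡0F (subst (l <_) (trans (sym p≡h) p≡1) l<h)

  gen-preserves-upper : ∀ {y z} → ΔGen Γ y z →
                        ΔPoint Γ y ≢ 1F → upper y ≡ ΔPoint Γ y → lower z ≡ 1F → upper y ≡ upper z
  gen-preserves-upper (_ , _ , (_ , y∈z) , _) y≢1 upper≡y lower≡1 with y∈z
  ... | inj₁ y≡lower = ⊥-elim (y≢1 (trans y≡lower lower≡1))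
  ... | inj₂ y≡upper = trans upper≡y y≡upper

  residue-gen-upper : ∀ {y z} → InResidue y → InResidue z → ΔGen Γ y z → upper y ≡ upper z
  residue-gen-upper {y} {z} y∈ z∈ gyz with residue-gen y∈ | residue-gen z∈
  ... | inj₁ x₀y | inj₂ zx₀ =
    let (_ , y≢1 , upper≡y) = gen-from-x₀ y x₀y
        (_ , lower≡1)       = gen-to-x₀ z zx₀
    in gen-preserves-upper {y} {z} gyz y≢1 upper≡y lower≡1
  ... | inj₁ x₀y | inj₁ x₀z =
    case ΔGen-type Γ {y} {z} gyz (proj₁ (gen-from-x₀ y x₀y)) (proj₁ (gen-from-x₀ z x₀z)) of λ ()
  ... | inj₂ yx₀ | inj₁ x₀z =
    case ΔGen-type Γ {y} {z} gyz (proj₁ (gen-to-x₀ y yx₀)) (proj₁ (gen-from-x₀ z x₀z)) of λ ()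
  ... | inj₂ yx₀ | inj₂ zx₀ =
    case ΔGen-type Γ {y} {z} gyz (proj₁ (gen-to-x₀ y yx₀)) (proj₁ (gen-to-x₀ z zx₀)) of λ ()

  residue-adjacent-upper : ∀ {y z} → InResidue y → InResidue z →
                           Adjacent (ΔK (2 ℕ.+ n)) y z → upper y ≡ upper z
  residue-adjacent-upper _  _  (inj₁ y≡z , ty≢tz)  = ⊥-elim (ty≢tz (cong (ΔType Γ) y≡z))
  residue-adjacent-upper y∈ z∈ (inj₂ (inj₁ gyz) , _) = residue-gen-upper y∈ z∈ gyz
  residue-adjacent-upper y∈ z∈ (inj₂ (inj₂ gzy) , _) = sym (residue-gen-upper z∈ y∈ gzy)

  residue-path-upper : ∀ {y z : Σ (Elt (2 ℕ.+ n)) InResidue} →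
                       Star (λ a b → Adjacent (ΔK (2 ℕ.+ n)) (proj₁ a) (proj₁ b)) y z →
                       upper (proj₁ y) ≡ upper (proj₁ z)
  residue-path-upper = fold (λ a b → upper (proj₁ a) ≡ upper (proj₁ b))
                            (λ {a} {b} adj eq → trans (residue-adjacent-upper (proj₂ a) (proj₂ b) adj) eq)
                            refl

  from-x₀-in-residue : ∀ b (b≢0 : b ≢ 0F) → 1F ≢ b → InResidue (flag b 0F b≢0 1F)
  from-x₀-in-residue b b≢0 1≢b =
    inj₂ (inj₁ (flag-gen (λ ()) b≢0 1≢b 0F)) , λ y≡x₀ → case cong (ΔType Γ) y≡x₀ of λ ()

¬residuallyConnected : ∀ {n} → ¬ ResiduallyConnected (ΔK (4 ℕ.+ n))
¬residuallyConnected {n} residuallyConnected =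
  case residue-path-upper (residuallyConnected (just x₀) (y₂ , y₂∈) (y₃ , y₃∈)) of λ ()
  where
  open ResidueOfBaseFlag {2 ℕ.+ n}
  y₂ y₃ : Elt (4 ℕ.+ n)
  y₂ = flag 2F 0F (λ ()) 1F
  y₃ = flag 3F 0F (λ ()) 1F
  y₂∈ : InResidue y₂
  y₂∈ = from-x₀-in-residue 2F (λ ()) (λ ())
  y₃∈ : InResidue y₃
  y₃∈ = from-x₀-in-residue 3F (λ ()) (λ ())

proposition5p5 : (v : ℕ) → 4 ≤ v →
    Connected (TriangleComplex (KGeometry v))
      × ¬ ResiduallyConnected (TriangleComplex (KGeometry v))
proposition5p5 v 4≤v@(s≤s (s≤s (s≤s (s≤s _)))) = Connectivity.connected 4≤v , ¬residuallyConnected
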